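{- Let $N$ be a natural number, and let $\mathcal{T}_N$ be the class of all finite digraphs $D$ whose vertex set can be split into a disjoint union $D_e\cup D_c\cup D_f$ such that: (i) the digraph induced on $D_e$ is empty, i.e. it has no edge $(x,y)$ with $x\neq y$, and it is either reflexive or irreflexive; (ii) the digraph induced on $D_c$ is complete and reflexive, i.e. every pair $(x,y)$ with $x,y\in D_c$ (including $x=y$) is an edge; (iii) $|D_f|\le N$; (iv) the connections between $D_e$ and $D_c$ are uniform: for all $x,y\in D_e$ and all $z,t\in D_c$ we have $(x,z)\in E(D)\Leftrightarrow (y,t)\in E(D)$ and $(z,x)\in E(D)\Leftrightarrow (t,y)\in E(D)$. Then $\mathcal{T}_N$ is well quasi-ordered under both the standard homomorphic image ordering and the strong homomorphic image ordering.
   Context: A digraph is a set $D$ with a binary relation $E(D)\subseteq D\times D$ (its edges); all structures are finite. A digraph is reflexive if $(x,x)\in E(D)$ for all $x$, irreflexive if no $(x,x)$ is an edge. For digraphs $S,T$, a map $\phi:S\to T$ is a homomorphism if $(s_1,s_2)\in E(S)$ implies $(\phi(s_1),\phi(s_2))\in E(T)$; it is a strong homomorphism if moreover $\{(\phi(s_1),\phi(s_2)):(s_1,s_2)\in E(S)\}$ equals $E(T)\cap(\phi(S)\times\phi(S))$. A surjective (strong) homomorphism is a (strong) epimorphism. The homomorphic image ordering on a class of digraphs is given by $A\preceq B$ iff there is an epimorphism $B\to A$; the strong homomorphic image ordering by $A\preceq B$ iff there is a strong epimorphism $B\to A$ (structures are considered up to isomorphism). A class is well quasi-ordered (wqo)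 under an ordering if it contains no infinite strictly decreasing sequence and no infinite antichain (set of pairwise incomparable elements). -}

module Defs where

open import Data.Nat using (ℕ; suc; _≤_)
open import Data.Fin using (Fin)
open import Data.Bool using (Bool; true; false)
open import Data.List using (List; length; filterᵇ; allFin)
open import Data.Product using (Σ; ∃; ∃-syntax; _×_; _,_)
open import Data.Sum using (_⊎_)
open import Relation.Nullary using (¬_)
open import Relation.Binary.PropositionalEquality using (_≡_; _≢_)

record Digraph : Set where
  field
    size : ℕ
    edge : Fin size → Fin size → Bool
open Digraph public

E : (D : Digraph) → Fin (size D) → Fin (size D) → Set
E D x y = edge D x y ≡ true

IsHom : (S T : Digraph) → (Fin (size S) → Fin (size T)) → Set
IsHom S T φ = ∀ s₁ s₂ → E S s₁ s₂ → E T (φ s₁) (φ s₂)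

Surjective : {m n : ℕ} → (Fin m → Fin n) → Set
Surjective {m} {n} φ = ∀ (t : Fin n) → ∃[ s ] (φ s ≡ t)

IsStrongHom : (S T : Digraph) → (Fin (size S) → Fin (size T)) → Set
IsStrongHom S T φ =
  IsHom S T φ ×
  (∀ s₁ s₂ → E T (φ s₁) (φ s₂) →
     ∃[ s₁' ] ∃[ s₂' ] (φ s₁' ≡ φ s₁ × φ s₂' ≡ φ s₂ × E S s₁' s₂'))

_⪯h_ : Digraph → Digraph → Set
A ⪯h B = ∃[ φ ] (IsHom B A φ × Surjective φ)

_⪯s_ : Digraph → Digraph → Set
A ⪯s B = ∃[ φ ] (IsStrongHom B A φ × Surjective φ)

WQO : (P : Digraph → Set) → (Digraph → Digraph → Set) → Set
WQO P _≼_ =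
  (¬ (Σ (ℕ → Digraph) λ f → (∀ i → P (f i)) ×
        (∀ i → (f (suc i) ≼ f i) × ¬ (f i ≼ f (suc i)))))
  ×
  (¬ (Σ (ℕ → Digraph) λ f → (∀ i → P (f i)) ×
        (∀ i j → i ≢ j → ¬ (f i ≼ f j))))

data Part : Set where
  pe pc pf : Part

isF : Part → Bool
isF pf = true
isF _  = false

InT : ℕ → Digraph → Set
InT N D = Σ (Fin (size D) → Part) λ part →
  (∀ x y → part x ≡ pe → part y ≡ pe → x ≢ y → ¬ E D x y) ×
  ((∀ x → part x ≡ pe → E D x x) ⊎ (∀ x → part x ≡ pe → ¬ E D x x)) ×
  (∀ x y → part x ≡ pc → part y ≡ pc → E D x y) ×
  (length (filterᵇ (λ x → isF (part x)) (allFin (size D))) ≤ N) ×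
  (∀ x y z t → part x ≡ pe → part y ≡ pe → part z ≡ pc → part t ≡ pc →
     (E D x z → E D y t) × (E D y t → E D x z) ×
     (E D z x → E D t y) × (E D t y → E D z x))

-- Each D in T_N is determined by a labelling of its vertices with labels from a finite set that
-- depends only on N: a label records the part of the vertex, the slot of a D_f-vertex, the edges
-- between the vertex and every slot, its loop, and its edges to and from D_c (the same for all of
-- D_c, by (iv)). A label-preserving surjection between such digraphs is a strong epimorphism,
-- and one exists from B onto A as soon as every label occurs in A at most as often as in B, and
-- occurs in A whenever it occurs in B. Dickson's lemma for these count vectors, proved
-- constructively with almost-full relations, yields i < j with f i ⪯s f j in every sequence f,
-- which rules out infinite antichains and strictly descending sequences for ⪯s and for ⪯h ⊇ ⪯s.

module Submission where

open import Defs
open import Data.Nat using (ℕ; zero; suc; _+_; _∸_; _≤_; _<_; z≤n; s≤s; _≤?_; _<?_)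
open import Data.Nat.Properties using (≤-trans; ≰⇒>; <⇒≢; m∸n+n≡m; m≤n⇒m≤1+n) renaming (_≟_ to _≟ℕ_)
open import Data.Bool using (Bool; true; false; T?)
open import Data.Bool.Properties using (¬-not; ⇔→≡; T-≡) renaming (_≟_ to _≟ᴮ_)
open import Data.Fin using (Fin; zero; suc; toℕ; fromℕ<; inject≤) renaming (_≟_ to _≟ᶠ_)
open import Data.Fin.Properties using (any?; toℕ-injective; toℕ-fromℕ<; toℕ-inject≤; toℕ<n)
open import Data.List
  using (List; []; _∷_; length; filter; filterᵇ; allFin; lookup; cartesianProduct; cartesianProductWith)
open import Data.List.Membership.Propositional using (_∈_)
open import Data.List.Membership.Propositional.Properties
  using (∈-filter⁺; ∈-filter⁻; ∈-allFin; ∈-lookup; ∈-cartesianProduct⁺; ∈-cartesianProductWith⁺)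
open import Data.List.Membership.Propositional.Properties.WithK using (unique⇒irrelevant)
import Data.List.Membership.DecPropositional as DecMembership
open import Data.List.Relation.Unary.All using (All; []; _∷_; all?)
import Data.List.Relation.Unary.All as All
open import Data.List.Relation.Unary.Any using (index; here; there)
open import Data.List.Relation.Unary.Any.Properties using (lookup-index)
open import Data.List.Relation.Unary.Unique.Propositional using (Unique)
import Data.List.Relation.Unary.Unique.Propositional.Properties as Unique
open import Data.Product using (Σ; ∃-syntax; _×_; _,_; proj₁; proj₂; uncurry)
open import Data.Product.Properties using () renaming (≡-dec to ×-≡-dec)
open import Data.Sum using (_⊎_; inj₁; inj₂; [_,_]′)
open import Data.Empty using (⊥-elim)
open import Data.Vec using (Vec; []; _∷_; tabulate) renaming (lookup to lookupᵛ)
open import Data.Vec.Properties using (lookup∘tabulate) renaming (≡-dec to Vec-≡-dec)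
open import Function using (id; _∘_; _on_)
open import Function.Bundles using (mk⇔; Equivalence)
open import Level using (0ℓ)
open import Relation.Binary.Core using (Rel; _⇒_)
open import Relation.Binary.Definitions using (Decidable; DecidableEquality)
open import Relation.Binary.Construct.Intersection using (_∩_; decidable)
open import Relation.Binary.PropositionalEquality
  using (_≡_; _≢_; refl; sym; trans; cong; cong₂; subst; module ≡-Reasoning)
open import Relation.Nullary using (¬_; Dec; yes; no; _→-dec_)
open import Relation.Nullary.Decidable using (toSum)
open import Relation.Unary as U using (Pred; _∪_; ∅)
open import Relation.Unary.Properties using (_∪?_; ∅?)

private
  variable
    X Y : Set
    R R′ S T : Rel X 0ℓ
    P Q W : Pred X 0ℓ

-- Almost-full relations

data _⊕_ {X : Set} (R : Rel X 0ℓ) (P : Pred X 0ℓ) (y z : X) : Set where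
  rel  : R y z → (R ⊕ P) y z
  pred : P y   → (R ⊕ P) y z

infixl 5 _⊕_

-- The inductive presentation of Vytiniotis, Coquand and Wahlstedt, "Stop when you are almost-full".
data AlmostFull {X : Set} : Rel X 0ℓ → Set₁ where
  full : (∀ x y → R x y) → AlmostFull R
  step : (∀ x → AlmostFull (R ⊕ R x)) → AlmostFull R

⊕-map : R ⇒ S → P U.⊆ Q → R ⊕ P ⇒ S ⊕ Q
⊕-map R⇒S P⊆Q (rel r)  = rel (R⇒S r)
⊕-map R⇒S P⊆Q (pred p) = pred (P⊆Q p)

almostFull-mono : R ⇒ S → AlmostFull R → AlmostFull S
almostFull-mono R⇒S (full R-full) = full λ x y → R⇒S (R-full x y)
almostFull-mono R⇒S (step R-af)   = step λ x → almostFull-mono (⊕-map R⇒S R⇒S) (R-af x)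

almostFull-on : (f : Y → X) → AlmostFull R → AlmostFull (R on f)
almostFull-on f (full R-full) = full λ x y → R-full (f x) (f y)
almostFull-on f (step R-af)   = step λ x → almostFull-mono ⊕-on (almostFull-on f (R-af (f x)))
  where
  ⊕-on : ∀ {P : Pred _ 0ℓ} → ((R ⊕ P) on f) ⇒ (R on f) ⊕ (λ y → P (f y))
  ⊕-on (rel r)  = rel r
  ⊕-on (pred p) = pred p

almostFull⇒good : AlmostFull R → (s : ℕ → X) → ∃[ i ] ∃[ j ] i < j × R (s i) (s j)
almostFull⇒good (full R-full) s = 0 , 1 , s≤s z≤n , R-full (s 0) (s 1)
almostFull⇒good (step R-af) s with almostFull⇒good (R-af (s 0)) (λ n → s (suc n))
... | i , j , i<j , rel r  = suc i , suc j , s≤s i<j , r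
... | i , j , i<j , pred r = 0 , suc i , s≤s z≤n , r

almostFull-≤-⊕-≥ : ∀ m → AlmostFull (_≤_ ⊕ (m ≤_))
almostFull-≤-⊕-≥ zero    = full λ _ _ → pred z≤n
almostFull-≤-⊕-≥ (suc m) = step λ x → below-or-above x (x ≤? m)
  where
  below-or-above : ∀ x → Dec (x ≤ m) → AlmostFull ((_≤_ ⊕ (suc m ≤_)) ⊕ (_≤_ ⊕ (suc m ≤_)) x)
  below-or-above x (yes x≤m) =
    almostFull-mono (⊕-map rel λ m≤y → rel (≤-trans x≤m m≤y)) (almostFull-≤-⊕-≥ m)
  below-or-above x (no x≰m)  = full λ _ _ → pred (pred (≰⇒> x≰m))

almostFull-≤ : AlmostFull _≤_
almostFull-≤ = step almostFull-≤-⊕-≥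

almostFull-zero-reflecting : AlmostFull {ℕ} λ a b → a ≡ 0 → b ≡ 0
almostFull-zero-reflecting = step λ x → step λ y → full (reflecting x y)
  where
  Z : Rel ℕ 0ℓ
  Z a b = a ≡ 0 → b ≡ 0
  reflecting : ∀ x y z w → ((Z ⊕ Z x) ⊕ (Z ⊕ Z x) y) z w
  reflecting (suc _) _       _ _ = rel (pred λ ())
  reflecting zero    zero    _ _ = pred (pred λ _ → refl)
  reflecting zero    (suc _) _ _ = pred (rel λ ())

⊕-absorb : ∀ x → S ⇒ R ⊕ P → ¬ P x → S ⊕ S x ⇒ R ⊕ (P ∪ R x)
⊕-absorb x S⇒ ¬px (rel s) = ⊕-map id inj₁ (S⇒ s)
⊕-absorb x S⇒ ¬px (pred s) with S⇒ s
... | rel r   = pred (inj₂ r)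
... | pred px = ⊥-elim (¬px px)

⊕-meet : S ⇒ R ⊕ P → T ⇒ R ⊕ Q → S ∩ T ⇒ R ⊕ (P U.∩ Q)
⊕-meet S⇒ T⇒ (s , t) with S⇒ s | T⇒ t
... | rel r  | _      = rel r
... | pred _ | rel r  = rel r
... | pred p | pred q = pred (p , q)

∩-⊕ : S ⇒ R ⊕ W → T ⇒ R′ ⊕ W → S ∩ T ⇒ (R ∩ R′) ⊕ W
∩-⊕ S⇒ T⇒ (s , t) with S⇒ s | T⇒ t
... | pred w | _      = pred w
... | rel _  | pred w = pred w
... | rel r  | rel r′ = rel (r , r′)

both-or-refuted : {A B : Set} → Dec A → Dec B → (A × B) ⊎ (¬ A ⊎ ¬ B)
both-or-refuted (yes a) (yes b) = inj₁ (a , b)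
both-or-refuted (no ¬a) _       = inj₂ (inj₁ ¬a)
both-or-refuted (yes _) (no ¬b) = inj₂ (inj₂ ¬b)

-- The intersection theorem (a constructive Ramsey argument), by induction on both witnesses at
-- once: at a new point x, decidability tells which side condition fails at x, and that side
-- takes a step while absorbing R x into its side condition.
almostFull-⊕-∩ : Decidable R → U.Decidable P → U.Decidable Q →
                 AlmostFull S → S ⇒ R ⊕ P → AlmostFull T → T ⇒ R ⊕ Q →
                 AlmostFull (R ⊕ (P U.∩ Q))
almostFull-⊕-∩ R? P? Q? (full S-full) S⇒ T-af T⇒ =
  almostFull-mono (λ {y} {z} t → ⊕-meet S⇒ T⇒ (S-full y z , t)) T-af
almostFull-⊕-∩ R? P? Q? S-af S⇒ (full T-full) T⇒ =
  almostFull-mono (λ {y} {z} s → ⊕-meet S⇒ T⇒ (s , T-full y z)) S-af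
almostFull-⊕-∩ {R = R} {P = P} {Q = Q} R? P? Q? (step S-af) S⇒ (step T-af) T⇒ =
  step λ x →
    [ (λ (px , qx) → full λ _ _ → pred (pred (px , qx)))
    , [ (λ ¬px → almostFull-mono (weakenˡ x)
          (almostFull-⊕-∩ R? (P? ∪? R? x) Q? (S-af x) (⊕-absorb x S⇒ ¬px) (step T-af) T⇒))
      , (λ ¬qx → almostFull-mono (weakenʳ x)
          (almostFull-⊕-∩ R? P? (Q? ∪? R? x) (step S-af) S⇒ (T-af x) (⊕-absorb x T⇒ ¬qx)))
      ]′
    ]′ (both-or-refuted (P? x) (Q? x))
  where
  weakenˡ : ∀ x → R ⊕ ((P ∪ R x) U.∩ Q) ⇒ (R ⊕ (P U.∩ Q)) ⊕ (R ⊕ (P U.∩ Q)) x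
  weakenˡ x (rel r)              = rel (rel r)
  weakenˡ x (pred (inj₁ p , q)) = rel (pred (p , q))
  weakenˡ x (pred (inj₂ r , _)) = pred (rel r)
  weakenʳ : ∀ x → R ⊕ (P U.∩ (Q ∪ R x)) ⇒ (R ⊕ (P U.∩ Q)) ⊕ (R ⊕ (P U.∩ Q)) x
  weakenʳ x (rel r)              = rel (rel r)
  weakenʳ x (pred (p , inj₁ q)) = rel (pred (p , q))
  weakenʳ x (pred (_ , inj₂ r)) = pred (rel r)

almostFull-∩-⊕ : Decidable R → Decidable R′ → U.Decidable W →
                 AlmostFull S → S ⇒ R ⊕ W → AlmostFull T → T ⇒ R′ ⊕ W →
                 AlmostFull ((R ∩ R′) ⊕ W)
almostFull-∩-⊕ R? R′? W? (full S-full) S⇒ T-af T⇒ =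
  almostFull-mono (λ {y} {z} t → ∩-⊕ S⇒ T⇒ (S-full y z , t)) T-af
almostFull-∩-⊕ R? R′? W? S-af S⇒ (full T-full) T⇒ =
  almostFull-mono (λ {y} {z} s → ∩-⊕ S⇒ T⇒ (s , T-full y z)) S-af
almostFull-∩-⊕ {R = R} {R′ = R′} {W = W} R? R′? W? (step S-af) S⇒ (step T-af) T⇒ =
  step λ x →
    [ (λ wx → full λ _ _ → pred (pred wx))
    , (λ ¬wx → almostFull-mono (weaken x)
        (almostFull-⊕-∩ (decidable R? R′?) (W? ∪? R? x) (W? ∪? R′? x)
          (almostFull-∩-⊕ R? R′? (W? ∪? R? x)
            (S-af x) (⊕-absorb x S⇒ ¬wx) (step T-af) (⊕-map id inj₁ ∘ T⇒))
          id
          (almostFull-∩-⊕ R? R′? (W? ∪? R′? x)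
            (step S-af) (⊕-map id inj₁ ∘ S⇒) (T-af x) (⊕-absorb x T⇒ ¬wx))
          id))
    ]′ (toSum (W? x))
  where
  weaken : ∀ x → (R ∩ R′) ⊕ ((W ∪ R x) U.∩ (W ∪ R′ x)) ⇒ ((R ∩ R′) ⊕ W) ⊕ ((R ∩ R′) ⊕ W) x
  weaken x (rel r)                   = rel (rel r)
  weaken x (pred (inj₁ w , _))       = rel (pred w)
  weaken x (pred (inj₂ _ , inj₁ w))  = rel (pred w)
  weaken x (pred (inj₂ r , inj₂ r′)) = pred (rel (r , r′))

almostFull-∩ : Decidable R → Decidable R′ → AlmostFull R → AlmostFull R′ → AlmostFull (R ∩ R′)
almostFull-∩ R? R′? R-af R′-af =
  almostFull-mono drop-∅ (almostFull-∩-⊕ R? R′? ∅? R-af rel R′-af rel)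
  where
  drop-∅ : (R ∩ R′) ⊕ ∅ ⇒ R ∩ R′
  drop-∅ (rel r) = r

almostFull-All : Decidable R → AlmostFull R → (ls : List Y) →
                 AlmostFull (λ (g h : Y → X) → All (λ l → R (g l) (h l)) ls)
almostFull-All R? R-af []       = full λ _ _ → []
almostFull-All R? R-af (l ∷ ls) =
  almostFull-mono (uncurry _∷_)
    (almostFull-∩ (λ g h → R? (g l) (h l)) (λ g h → all? (λ l′ → R? (g l′) (h l′)) ls)
                  (almostFull-on (λ g → g l) R-af) (almostFull-All R? R-af ls))

-- Surjections from counts

_⊑_ : Rel ℕ 0ℓ
a ⊑ b = a ≤ b × (a ≡ 0 → b ≡ 0)

_⊑?_ : Decidable _⊑_
_⊑?_ = decidable _≤?_ λ a b → (a ≟ℕ 0) →-dec (b ≟ℕ 0)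

almostFull-⊑ : AlmostFull _⊑_
almostFull-⊑ =
  almostFull-∩ _≤?_ (λ a b → (a ≟ℕ 0) →-dec (b ≟ℕ 0)) almostFull-≤ almostFull-zero-reflecting

clamp : ∀ {m} n → Fin m → Fin (suc n)
clamp zero    _       = zero
clamp (suc n) zero    = zero
clamp (suc n) (suc i) = suc (clamp n i)

clamp-inject≤ : ∀ {n m} (i : Fin (suc n)) (le : suc n ≤ m) → clamp n (inject≤ i le) ≡ i
clamp-inject≤ {zero}  zero    (s≤s _)  = refl
clamp-inject≤ {suc n} zero    (s≤s _)  = refl
clamp-inject≤ {suc n} (suc i) (s≤s le) = cong suc (clamp-inject≤ i le)

⊑⇒surjection : ∀ {a b} → a ⊑ b → Σ (Fin b → Fin a) Surjective
⊑⇒surjection {zero}  {zero}  _         = (λ ()) , λ ()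
⊑⇒surjection {zero}  {suc b} (_ , 0⇒0) with () ← 0⇒0 refl
⊑⇒surjection {suc a}         (a≤b , _) = clamp a , λ t → inject≤ t a≤b , clamp-inject≤ t a≤b

index-∈-lookup : ∀ {A : Set} (xs : List A) i → index (∈-lookup {xs = xs} i) ≡ i
index-∈-lookup (x ∷ xs) zero    = refl
index-∈-lookup (x ∷ xs) (suc i) = cong suc (index-∈-lookup xs i)

module _ {L : Set} (_≟ᴸ_ : DecidableEquality L) where

  fibre : ∀ {m} → (Fin m → L) → L → List (Fin m)
  fibre f l = filter (λ x → f x ≟ᴸ l) (allFin _)

  count : ∀ {m} → (Fin m → L) → L → ℕ
  count f l = length (fibre f l)

  module _ {m} (f : Fin m → L) where

    ∈-fibre : ∀ x → x ∈ fibre f (f x)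
    ∈-fibre x = ∈-filter⁺ (λ y → f y ≟ᴸ f x) (∈-allFin x) refl

    ∈-fibre⁻ : ∀ {x l} → x ∈ fibre f l → f x ≡ l
    ∈-fibre⁻ x∈ = proj₂ (∈-filter⁻ (λ y → f y ≟ᴸ _) {xs = allFin m} x∈)

    fibre-unique : ∀ l → Unique (fibre f l)
    fibre-unique l = Unique.filter⁺ (λ y → f y ≟ᴸ l) (Unique.allFin⁺ m)

  -- The k-th point of a fibre of f goes to the min(k, c - 1)-th point of the fibre of g, of size c.
  fibrewise-surjection : ∀ {m n} (f : Fin m → L) (g : Fin n → L) → (∀ l → count g l ⊑ count f l) →
                         Σ (Fin m → Fin n) λ φ → (∀ x → g (φ x) ≡ f x) × Surjective φ
  fibrewise-surjection {m} {n} f g g⊑f = φ , φ-label , φ-onto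
    where
    squeeze : ∀ l → Fin (count f l) → Fin (count g l)
    squeeze l = proj₁ (⊑⇒surjection (g⊑f l))

    pick : ∀ {x} l → x ∈ fibre f l → Fin n
    pick l x∈ = lookup (fibre g l) (squeeze l (index x∈))

    φ : Fin m → Fin n
    φ x = pick (f x) (∈-fibre f x)

    φ-label : ∀ x → g (φ x) ≡ f x
    φ-label x = ∈-fibre⁻ g (∈-lookup (squeeze (f x) (index (∈-fibre f x))))

    φ≡pick : ∀ {x l} → f x ≡ l → (x∈ : x ∈ fibre f l) → φ x ≡ pick l x∈
    φ≡pick refl x∈ = cong (pick _) (unique⇒irrelevant (fibre-unique f _) (∈-fibre f _) x∈)

    φ-lookup : ∀ l i → φ (lookup (fibre f l) i) ≡ lookup (fibre g l) (squeeze l i)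
    φ-lookup l i = begin
      φ (lookup (fibre f l) i)                   ≡⟨ φ≡pick (∈-fibre⁻ f x∈) x∈ ⟩
      lookup (fibre g l) (squeeze l (index x∈))  ≡⟨ cong (lookup (fibre g l) ∘ squeeze l)
                                                          (index-∈-lookup (fibre f l) i) ⟩
      lookup (fibre g l) (squeeze l i)           ∎
      where
      open ≡-Reasoning
      x∈ : lookup (fibre f l) i ∈ fibre f l
      x∈ = ∈-lookup i

    φ-onto : Surjective φ
    φ-onto y with proj₂ (⊑⇒surjection (g⊑f (g y))) (index (∈-fibre g y))
    ... | i , squeeze-i = lookup (fibre f (g y)) i , (begin
      φ (lookup (fibre f (g y)) i)                  ≡⟨ φ-lookup (g y) i ⟩
      lookup (fibre g (g y)) (squeeze (g y) i)      ≡⟨ cong (lookup (fibre g (g y))) squeeze-i ⟩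
      lookup (fibre g (g y)) (index (∈-fibre g y))  ≡⟨ sym (lookup-index (∈-fibre g y)) ⟩
      y                                             ∎)
      where open ≡-Reasoning

-- Digraphs whose edges are read off vertex labels

-- link⇒loop is what allows a label-preserving map to merge two adjacent vertices with equal labels.
record Adjacency (L : Set) : Set where
  field
    loop      : L → Bool
    link      : L → L → Bool
    link⇒loop : ∀ l → link l l ≡ true → loop l ≡ true

module _ {L : Set} (adj : Adjacency L) where
  open Adjacency adj

  record IsAdjacencyLabelling (D : Digraph) (ℓ : Fin (size D) → L) : Set where
    field
      loop-edge : ∀ u → edge D u u ≡ loop (ℓ u)
      link-edge : ∀ {u v} → u ≢ v → edge D u v ≡ link (ℓ u) (ℓ v)

    link⇒E : ∀ u v → link (ℓ u) (ℓ v) ≡ true → E D u v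
    link⇒E u v link≡true with u ≟ᶠ v
    ... | yes refl = trans (loop-edge u) (link⇒loop (ℓ u) link≡true)
    ... | no u≢v   = trans (link-edge u≢v) link≡true

  open IsAdjacencyLabelling

  label-preserving⇒strongHom :
    ∀ {C D ℓC ℓD} → IsAdjacencyLabelling C ℓC → IsAdjacencyLabelling D ℓD →
    (φ : Fin (size C) → Fin (size D)) → (∀ x → ℓD (φ x) ≡ ℓC x) → IsStrongHom C D φ
  label-preserving⇒strongHom {C} {D} {ℓC} {ℓD} C-labelling D-labelling φ φ-label = hom , strong
    where
    open ≡-Reasoning

    loop-preserved : ∀ u → edge D (φ u) (φ u) ≡ edge C u u
    loop-preserved u = begin
      edge D (φ u) (φ u)  ≡⟨ loop-edge D-labelling (φ u) ⟩
      loop (ℓD (φ u))     ≡⟨ cong loop (φ-label u) ⟩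
      loop (ℓC u)         ≡⟨ sym (loop-edge C-labelling u) ⟩
      edge C u u          ∎

    link-preserved : ∀ u v → link (ℓD (φ u)) (ℓD (φ v)) ≡ link (ℓC u) (ℓC v)
    link-preserved u v = cong₂ link (φ-label u) (φ-label v)

    hom : IsHom C D φ
    hom u v e with u ≟ᶠ v
    ... | yes refl = trans (loop-preserved u) e
    ... | no u≢v   =
      link⇒E D-labelling (φ u) (φ v) (trans (link-preserved u v) (trans (sym (link-edge C-labelling u≢v)) e))

    strong : ∀ u v → E D (φ u) (φ v) → ∃[ u′ ] ∃[ v′ ] (φ u′ ≡ φ u × φ v′ ≡ φ v × E C u′ v′)
    strong u v e with φ u ≟ᶠ φ v
    ... | yes φu≡φv =
      u , u , refl , φu≡φv , trans (sym (loop-preserved u)) (subst (E D (φ u)) (sym φu≡φv) e)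
    ... | no φu≢φv  = u , v , refl , refl , (begin
      edge C u v                  ≡⟨ link-edge C-labelling (φu≢φv ∘ cong φ) ⟩
      link (ℓC u) (ℓC v)          ≡⟨ sym (link-preserved u v) ⟩
      link (ℓD (φ u)) (ℓD (φ v))  ≡⟨ sym (link-edge D-labelling φu≢φv) ⟩
      edge D (φ u) (φ v)          ≡⟨ e ⟩
      true                        ∎)

counts⇒⪯s : ∀ {L} (_≟ᴸ_ : DecidableEquality L) (adj : Adjacency L) {A B ℓA ℓB} →
            IsAdjacencyLabelling adj A ℓA → IsAdjacencyLabelling adj B ℓB →
            (∀ l → count _≟ᴸ_ ℓA l ⊑ count _≟ᴸ_ ℓB l) → A ⪯s B
counts⇒⪯s _≟ᴸ_ adj {ℓA = ℓA} {ℓB} A-labelling B-labelling counts⊑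
  with fibrewise-surjection _≟ᴸ_ ℓB ℓA counts⊑
... | φ , φ-label , φ-onto = φ , label-preserving⇒strongHom adj B-labelling A-labelling φ φ-label , φ-onto

-- The two image orderings

⪯h-refl : ∀ A → A ⪯h A
⪯h-refl _ = id , (λ _ _ e → e) , λ t → t , refl

⪯s-refl : ∀ A → A ⪯s A
⪯s-refl _ = id , ((λ _ _ e → e) , λ s₁ s₂ e → s₁ , s₂ , refl , refl , e) , λ t → t , refl

∘-surjective : ∀ {l m n} {φ : Fin m → Fin n} {ψ : Fin l → Fin m} →
               Surjective φ → Surjective ψ → Surjective (φ ∘ ψ)
∘-surjective {φ = φ} φ-onto ψ-onto t with φ-onto t
... | b , φb≡t with ψ-onto b
...   | c , ψc≡b = c , trans (cong φ ψc≡b) φb≡t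

⪯h-trans : ∀ A B C → A ⪯h B → B ⪯h C → A ⪯h C
⪯h-trans _ _ _ (φ , φ-hom , φ-onto) (ψ , ψ-hom , ψ-onto) =
  φ ∘ ψ , (λ x y e → φ-hom _ _ (ψ-hom x y e)) , ∘-surjective φ-onto ψ-onto

⪯s-trans : ∀ A B C → A ⪯s B → B ⪯s C → A ⪯s C
⪯s-trans A B C (φ , (φ-hom , φ-strong) , φ-onto) (ψ , (ψ-hom , ψ-strong) , ψ-onto) =
  φ ∘ ψ , ((λ x y e → φ-hom _ _ (ψ-hom x y e)) , strong) , ∘-surjective φ-onto ψ-onto
  where
  strong : ∀ c₁ c₂ → E A (φ (ψ c₁)) (φ (ψ c₂)) →
           ∃[ c₁′ ] ∃[ c₂′ ] (φ (ψ c₁′) ≡ φ (ψ c₁) × φ (ψ c₂′) ≡ φ (ψ c₂) × E C c₁′ c₂′)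
  strong c₁ c₂ e with φ-strong (ψ c₁) (ψ c₂) e
  ... | b₁ , b₂ , φb₁ , φb₂ , eB with ψ-onto b₁ | ψ-onto b₂
  ...   | d₁ , refl | d₂ , refl with ψ-strong d₁ d₂ eB
  ...     | c₁′ , c₂′ , ψc₁′ , ψc₂′ , eC =
    c₁′ , c₂′ , trans (cong φ ψc₁′) φb₁ , trans (cong φ ψc₂′) φb₂ , eC

⪯s⇒⪯h : ∀ A B → A ⪯s B → A ⪯h B
⪯s⇒⪯h _ _ (φ , (φ-hom , _) , φ-onto) = φ , φ-hom , φ-onto

module _ {P : Digraph → Set} {_≼_ : Digraph → Digraph → Set}
         (≼-refl : ∀ A → A ≼ A) (≼-trans : ∀ A B C → A ≼ B → B ≼ C → A ≼ C) where

  descending⇒≼ : ∀ {f : ℕ → Digraph} → (∀ i → f (suc i) ≼ f i) → ∀ i k → f (k + i) ≼ f i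
  descending⇒≼ desc i zero    = ≼-refl _
  descending⇒≼ desc i (suc k) = ≼-trans _ _ _ (desc (k + i)) (descending⇒≼ desc i k)

  good⇒WQO : (∀ f → (∀ i → P (f i)) → ∃[ i ] ∃[ j ] i < j × f i ≼ f j) → WQO P _≼_
  good⇒WQO good =
    (λ (f , f∈P , desc) → let i , j , i<j , fi≼fj = good f f∈P in
      proj₂ (desc i) (≼-trans _ _ _ fi≼fj (subst (λ n → f n ≼ f (suc i)) (m∸n+n≡m i<j)
                                               (descending⇒≼ (proj₁ ∘ desc) (suc i) (j ∸ suc i))))) ,
    (λ (f , f∈P , incomparable) → let i , j , i<j , fi≼fj = good f f∈P in
      incomparable i j (<⇒≢ i<j) fi≼fj)

-- Labels for the class T_N

_≟ᴾ_ : DecidableEquality Part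
pe ≟ᴾ pe = yes refl
pe ≟ᴾ pc = no λ ()
pe ≟ᴾ pf = no λ ()
pc ≟ᴾ pe = no λ ()
pc ≟ᴾ pc = yes refl
pc ≟ᴾ pf = no λ ()
pf ≟ᴾ pe = no λ ()
pf ≟ᴾ pc = no λ ()
pf ≟ᴾ pf = yes refl

Enumeration : Set → Set
Enumeration A = Σ (List A) λ xs → ∀ x → x ∈ xs

enum-Part : Enumeration Part
enum-Part = pe ∷ pc ∷ pf ∷ [] , λ where
  pe → here refl
  pc → there (here refl)
  pf → there (there (here refl))

enum-Bool : Enumeration Bool
enum-Bool = true ∷ false ∷ [] , λ { true → here refl ; false → there (here refl) }

enum-Fin : ∀ n → Enumeration (Fin n)
enum-Fin n = allFin n , ∈-allFin

enum-× : ∀ {A B} → Enumeration A → Enumeration B → Enumeration (A × B)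
enum-× (xs , ∈xs) (ys , ∈ys) = cartesianProduct xs ys , λ (x , y) → ∈-cartesianProduct⁺ (∈xs x) (∈ys y)

enum-Vec : ∀ {A} → Enumeration A → ∀ n → Enumeration (Vec A n)
enum-Vec _          zero    = [] ∷ [] , λ { [] → here refl }
enum-Vec (xs , ∈xs) (suc n) with enum-Vec (xs , ∈xs) n
... | vs , ∈vs =
  cartesianProductWith _∷_ xs vs , λ { (x ∷ v) → ∈-cartesianProductWith⁺ _∷_ (∈xs x) (∈vs v) }

module _ (N : ℕ) where

  Row : Set
  Row = Vec (Bool × Bool) (suc N)

  -- The label of v: its part, the slot of v among the D_f-vertices, for each slot the pair
  -- (E v w, E w v) with w the vertex in that slot, E v v, and E v c and E c v for c in D_c.
  -- The slot of a vertex outside D_f and the entries of unused slots are junk.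
  Label : Set
  Label = Part × Fin (suc N) × Row × Bool × Bool × Bool

  _≟ᴸ_ : DecidableEquality Label
  _≟ᴸ_ = ×-≡-dec _≟ᴾ_ (×-≡-dec _≟ᶠ_ (×-≡-dec (Vec-≡-dec (×-≡-dec _≟ᴮ_ _≟ᴮ_))
                                              (×-≡-dec _≟ᴮ_ (×-≡-dec _≟ᴮ_ _≟ᴮ_))))

  enum-Label : Enumeration Label
  enum-Label =
    enum-× enum-Part (enum-× (enum-Fin (suc N)) (enum-× (enum-Vec (enum-× enum-Bool enum-Bool) (suc N))
                                                        (enum-× enum-Bool (enum-× enum-Bool enum-Bool))))

  loopBit : Label → Bool
  loopBit (pf , i , r , _)        = proj₁ (lookupᵛ r i)
  loopBit (pe , _ , _ , self , _) = self
  loopBit (pc , _)                = true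

  linkBit : Label → Label → Bool
  linkBit (_ , _ , r , _)            (pf , j , _)                 = proj₁ (lookupᵛ r j)
  linkBit (pf , i , _)               (_ , _ , r , _)              = proj₂ (lookupᵛ r i)
  linkBit (pe , _)                   (pe , _)                     = false
  linkBit (pe , _ , _ , _ , toC , _) (pc , _)                     = toC
  linkBit (pc , _)                   (pe , _ , _ , _ , _ , fromC) = fromC
  linkBit (pc , _)                   (pc , _)                     = true

  adjacency : Adjacency Label
  adjacency = record { loop = loopBit ; link = linkBit ; link⇒loop = link⇒loop }
    where
    link⇒loop : ∀ l → linkBit l l ≡ true → loopBit l ≡ true
    link⇒loop (pf , _) link = link
    link⇒loop (pe , _) ()
    link⇒loop (pc , _) _    = refl

  module _ {D : Digraph} where

    part : InT N D → Fin (size D) → Part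
    part = proj₁

    e-discrete : (D∈T : InT N D) → ∀ {x y} → part D∈T x ≡ pe → part D∈T y ≡ pe → x ≢ y → ¬ E D x y
    e-discrete (_ , discrete , _) = discrete _ _

    c-complete : (D∈T : InT N D) → ∀ {x y} → part D∈T x ≡ pc → part D∈T y ≡ pc → E D x y
    c-complete (_ , _ , _ , complete , _) = complete _ _

    F-vertices : InT N D → List (Fin (size D))
    F-vertices D∈T = filterᵇ (λ x → isF (part D∈T x)) (allFin (size D))

    F-bound : (D∈T : InT N D) → length (F-vertices D∈T) ≤ N
    F-bound (_ , _ , _ , _ , bound , _) = bound

    ∈F-vertices : (D∈T : InT N D) → ∀ {v} → part D∈T v ≡ pf → v ∈ F-vertices D∈T
    ∈F-vertices D∈T {v} v∈f =
      ∈-filter⁺ (T? ∘ isF ∘ part D∈T) (∈-allFin v) (Equivalence.from T-≡ (cong isF v∈f))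

    out-uniform : (D∈T : InT N D) → ∀ {x z t} →
                  part D∈T x ≡ pe → part D∈T z ≡ pc → part D∈T t ≡ pc → E D x z → E D x t
    out-uniform (_ , _ , _ , _ , _ , uniform) x∈e z∈c t∈c =
      proj₁ (uniform _ _ _ _ x∈e x∈e z∈c t∈c)

    in-uniform : (D∈T : InT N D) → ∀ {x z t} →
                 part D∈T x ≡ pe → part D∈T z ≡ pc → part D∈T t ≡ pc → E D z x → E D t x
    in-uniform (_ , _ , _ , _ , _ , uniform) x∈e z∈c t∈c =
      proj₁ (proj₂ (proj₂ (uniform _ _ _ _ x∈e x∈e z∈c t∈c)))

  module T-labelling {D : Digraph} (D∈T : InT N D) where

    open DecMembership (_≟ᶠ_ {size D}) using (_∈?_)

    F : List (Fin (size D))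
    F = F-vertices D∈T

    slotOf : ∀ {v} → v ∈ F → Fin (suc N)
    slotOf v∈F = inject≤ (index v∈F) (m≤n⇒m≤1+n (F-bound D∈T))

    slot : Fin (size D) → Fin (suc N)
    slot v with v ∈? F
    ... | yes v∈F = slotOf v∈F
    ... | no _    = zero

    occupant : Fin (size D) → Fin (suc N) → Fin (size D)
    occupant default j with toℕ j <? length F
    ... | yes j<|F| = lookup F (fromℕ< j<|F|)
    ... | no _      = default

    occupant-slotOf : ∀ default {v} (v∈F : v ∈ F) → occupant default (slotOf v∈F) ≡ v
    occupant-slotOf default v∈F with toℕ (slotOf v∈F) <? length F
    ... | yes j<|F| =
      trans (cong (lookup F) (toℕ-injective (trans (toℕ-fromℕ< j<|F|) (toℕ-inject≤ (index v∈F) _))))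
            (sym (lookup-index v∈F))
    ... | no j≮|F|  =
      ⊥-elim (j≮|F| (subst (_< length F) (sym (toℕ-inject≤ (index v∈F) _)) (toℕ<n (index v∈F))))

    edges : Fin (size D) → Fin (size D) → Bool × Bool
    edges u w = edge D u w , edge D w u

    row : Fin (size D) → Row
    row u = tabulate (edges u ∘ occupant u)

    row-slot : ∀ u {v} → part D∈T v ≡ pf → lookupᵛ (row u) (slot v) ≡ edges u v
    row-slot u {v} v∈f with v ∈? F
    ... | yes v∈F =
      trans (lookup∘tabulate (edges u ∘ occupant u) (slotOf v∈F)) (cong (edges u) (occupant-slotOf u v∈F))
    ... | no v∉F  = ⊥-elim (v∉F (∈F-vertices D∈T v∈f))

    some-c : Dec (∃[ c ] part D∈T c ≡ pc)
    some-c = any? λ c → part D∈T c ≟ᴾ pc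

    toC fromC : Fin (size D) → Bool
    toC u with some-c
    ... | yes (c , _) = edge D u c
    ... | no _        = false
    fromC u with some-c
    ... | yes (c , _) = edge D c u
    ... | no _        = false

    toC-edge : ∀ {u v} → part D∈T u ≡ pe → part D∈T v ≡ pc → toC u ≡ edge D u v
    toC-edge u∈e v∈c with some-c
    ... | yes (c , c∈c) = ⇔→≡ (mk⇔ (out-uniform D∈T u∈e c∈c v∈c) (out-uniform D∈T u∈e v∈c c∈c))
    ... | no no-c       = ⊥-elim (no-c (_ , v∈c))

    fromC-edge : ∀ {u v} → part D∈T u ≡ pe → part D∈T v ≡ pc → fromC u ≡ edge D v u
    fromC-edge u∈e v∈c with some-c
    ... | yes (c , c∈c) = ⇔→≡ (mk⇔ (in-uniform D∈T u∈e c∈c v∈c) (in-uniform D∈T u∈e v∈c c∈c))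
    ... | no no-c       = ⊥-elim (no-c (_ , v∈c))

    label : Fin (size D) → Label
    label u = part D∈T u , slot u , row u , edge D u u , toC u , fromC u

    label-adjacency : IsAdjacencyLabelling adjacency D label
    label-adjacency = record { loop-edge = loop-edge ; link-edge = link-edge }
      where
      loop-edge : ∀ u → edge D u u ≡ loopBit (label u)
      loop-edge u with part D∈T u in u∈
      ... | pf = sym (cong proj₁ (row-slot u u∈))
      ... | pe = refl
      ... | pc = c-complete D∈T u∈ u∈

      link-edge : ∀ {u v} → u ≢ v → edge D u v ≡ linkBit (label u) (label v)
      link-edge {u} {v} u≢v with part D∈T u in u∈ | part D∈T v in v∈
      ... | _  | pf = sym (cong proj₁ (row-slot u v∈))
      ... | pf | pe = sym (cong proj₂ (row-slot v u∈))
      ... | pf | pc = sym (cong proj₂ (row-slot v u∈))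
      ... | pe | pe = ¬-not (e-discrete D∈T u∈ v∈ u≢v)
      ... | pe | pc = sym (toC-edge u∈ v∈)
      ... | pc | pe = sym (fromC-edge v∈ u∈)
      ... | pc | pc = c-complete D∈T u∈ v∈

  open T-labelling

  InT-sequence-good : (f : ℕ → Digraph) → (∀ i → InT N (f i)) → ∃[ i ] ∃[ j ] i < j × f i ⪯s f j
  InT-sequence-good f f∈T
    with almostFull⇒good (almostFull-All _⊑?_ almostFull-⊑ (proj₁ enum-Label))
                         (λ i → count _≟ᴸ_ (label (f∈T i)))
  ... | i , j , i<j , counts⊑ =
    i , j , i<j , counts⇒⪯s _≟ᴸ_ adjacency (label-adjacency (f∈T i)) (label-adjacency (f∈T j))
                            (λ l → All.lookup counts⊑ (proj₂ enum-Label l))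

theorem2p1 : (N : ℕ) → WQO (InT N) _⪯h_ × WQO (InT N) _⪯s_
theorem2p1 N =
  good⇒WQO {InT N} ⪯h-refl ⪯h-trans
    (λ f f∈T → let i , j , i<j , fi⪯fj = InT-sequence-good N f f∈T in
                 i , j , i<j , ⪯s⇒⪯h (f i) (f j) fi⪯fj) ,
  good⇒WQO {InT N} ⪯s-refl ⪯s-trans (InT-sequence-good N)
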